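{- For any finite simple connected graph $G$ and any path $P_n$ on $n\ge 1$ vertices, $\gamma_P(G)\le\gamma_P(G\Box P_n)\le\gamma(G)$. In particular, $\gamma_P(G)\le\gamma_P(G\Box P_2)\le\min\{\gamma(G),Z(G)\}$, and if $\gamma_P(G)=\gamma(G)$ then $\gamma_P(G\Box P_n)=\gamma(G)$.
   Context: The Cartesian product $G\Box H$ has vertex set $V(G)\times V(H)$, with $(g,h)$ adjacent to $(g',h')$ iff either $g=g'$ and $hh'\in E(H)$, or $h=h'$ and $gg'\in E(G)$. $\gamma(G)$ is the domination number. Zero forcing: for $U\subseteq V(G)$ (black vertices), repeatedly apply the rule "if a black vertex has exactly one white neighbor, that neighbor becomes black"; the resulting set is the closure $cl(U)$; $U$ is a zero forcing set if $cl(U)=V(G)$ and $Z(G)$ is the minimum size of a zero forcing set. A set $S$ is a power dominating set if $cl(N[S])=V(G)$, where $N[S]$ is the closed neighborhood of $S$; $\gamma_P(G)$ is the minimum cardinality of a power dominating set. -}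

module Defs where

open import Data.Nat using (ℕ; zero; suc; _*_; _≤_; _≡ᵇ_)
open import Data.Bool using (Bool; true; false; _∧_; _∨_)
open import Data.Fin using (Fin; toℕ; remQuot)
open import Data.Fin.Subset using (Subset; _∈_; ∣_∣)
open import Data.Product using (Σ; _×_; _,_; ∃)
open import Data.Sum using (_⊎_)
open import Relation.Binary.PropositionalEquality using (_≡_; _≢_)
open import Relation.Binary.Construct.Closure.ReflexiveTransitive using (Star)

record Graph : Set where
  field
    size : ℕ
    adj  : Fin size → Fin size → Bool
open Graph public

V : Graph → Set
V G = Fin (size G)

Adj : (G : Graph) → V G → V G → Set
Adj G u v = adj G u v ≡ true

IsSimple : Graph → Set
IsSimple G = (∀ u v → adj G u v ≡ adj G v u) × (∀ v → adj G v v ≡ false)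

Connected : Graph → Set
Connected G = ∀ u v → Star (Adj G) u v

_=ᶠ_ : ∀ {n} → Fin n → Fin n → Bool
i =ᶠ j = toℕ i ≡ᵇ toℕ j

_□_ : Graph → Graph → Graph
G □ H = record { size = size G * size H ; adj = a }
  where
  a : Fin (size G * size H) → Fin (size G * size H) → Bool
  a x y with remQuot {size G} (size H) x | remQuot {size G} (size H) y
  ... | (g , h) | (g' , h') = ((g =ᶠ g') ∧ adj H h h') ∨ ((h =ᶠ h') ∧ adj G g g')

Path : ℕ → Graph
Path n = record { size = n ; adj = λ i j → (suc (toℕ i) ≡ᵇ toℕ j) ∨ (suc (toℕ j) ≡ᵇ toℕ i) }

-- zero forcing closure of a set U (given as a predicate): the least set containing U
-- and closed under the colour change rule (a black vertex u all of whose neighbours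
-- other than v are black forces its neighbour v)
data InCl (G : Graph) (U : V G → Set) : V G → Set where
  base  : ∀ {v} → U v → InCl G U v
  force : ∀ {u v} → InCl G U u → Adj G u v →
          (∀ w → Adj G u w → w ≢ v → InCl G U w) → InCl G U v

InN : (G : Graph) → Subset (size G) → V G → Set
InN G S v = v ∈ S ⊎ ∃ λ u → u ∈ S × Adj G u v

IsDominating : (G : Graph) → Subset (size G) → Set
IsDominating G S = ∀ v → InN G S v

IsZeroForcing : (G : Graph) → Subset (size G) → Set
IsZeroForcing G U = ∀ v → InCl G (_∈ U) v

IsPowerDominating : (G : Graph) → Subset (size G) → Set
IsPowerDominating G S = ∀ v → InCl G (InN G S) v

IsMinCard : ∀ {n} → (Subset n → Set) → ℕ → Set
IsMinCard {n} P k = (Σ (Subset n) λ S → P S × ∣ S ∣ ≡ k) × (∀ S → P S → k ≤ ∣ S ∣)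

IsDomNumber IsPowerDomNumber IsZeroForcingNumber : Graph → ℕ → Set
IsDomNumber G = IsMinCard (IsDominating G)
IsPowerDomNumber G = IsMinCard (IsPowerDominating G)
IsZeroForcingNumber G = IsMinCard (IsZeroForcing G)

-- Lower bound: projecting a power dominating set S of G □ H onto G (keep g whenever some ⟨ g , h ⟩
-- lies in S) gives a power dominating set of G that is no larger, because a force inside a fibre
-- g × H projects to nothing new and a force ⟨ u , h ⟩ → ⟨ v , h ⟩ along a G-edge projects to the
-- force u → v of G.  Upper bounds: a set placed in layer 0 of G □ P_n observes D × {0} when D
-- dominates G, and then each ⟨ g , i ⟩ forces ⟨ g , i + 1 ⟩, since its other neighbours lie in
-- layers ≤ i; in G □ P_2 it observes Z × {0, 1} when Z is zero forcing for G, and every force of G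
-- then runs in both layers at once.

module Submission where

open import Defs
open import Data.Nat using (ℕ; _*_; _≤_; _⊓_; zero; suc; _≡ᵇ_; s≤s; z≤n)
open import Data.Nat.Properties using (≤-refl; ≤-trans; ≤-reflexive; ≤-antisym; ⊓-glb; m≤n⇒m≤1+n; ≡ᵇ⇒≡; ≡⇒≡ᵇ)
open import Data.Bool using (Bool; true; false; _∧_; _∨_)
open import Data.Bool.Properties using (T-≡; ∨-zeroʳ)
open import Data.Fin using (Fin; zero; suc; toℕ; inject₁; combine; remQuot; _<_)
open import Data.Fin.Properties using (toℕ-injective; toℕ-inject₁; remQuot-combine; combine-surjective; combine-injectiveˡ; ≤̄⇒inject₁<)
open import Data.Fin.Induction using (<-wellFounded)
open import Data.Fin.Subset using (Subset; _∈_; ∣_∣; ⊥)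
open import Data.Fin.Subset.Properties using (∣p∣≤∣x∷p∣)
open import Data.Vec using (Vec; []; _∷_; _++_; concat; map; lookup; group; foldr′; here; there)
open import Data.Vec.Properties using (lookup-concat; lookup-map; []=⇒lookup; lookup⇒[]=)
open import Data.Product using (_×_; _,_; proj₁; proj₂)
open import Data.Sum using (_⊎_; inj₁; inj₂)
open import Data.Empty using (⊥-elim)
open import Function using (Equivalence)
open import Induction.WellFounded using (Acc; acc)
open import Relation.Binary.PropositionalEquality using (_≡_; _≢_; refl; sym; trans; cong; cong₂; subst; module ≡-Reasoning)

∨≡true⇒ : ∀ x {y} → x ∨ y ≡ true → x ≡ true ⊎ y ≡ true
∨≡true⇒ true  _ = inj₁ refl
∨≡true⇒ false e = inj₂ e

∧≡true⇒ : ∀ x {y} → x ∧ y ≡ true → x ≡ true × y ≡ true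
∧≡true⇒ true e = refl , e

≡ᵇ≡true⇒≡ : ∀ m n → (m ≡ᵇ n) ≡ true → m ≡ n
≡ᵇ≡true⇒≡ m n e = ≡ᵇ⇒≡ m n (Equivalence.from T-≡ e)

≡ᵇ-refl : ∀ n → (n ≡ᵇ n) ≡ true
≡ᵇ-refl n = Equivalence.to T-≡ (≡⇒≡ᵇ n n refl)

=ᶠ⇒≡ : ∀ {n} (i j : Fin n) → (i =ᶠ j) ≡ true → i ≡ j
=ᶠ⇒≡ i j e = toℕ-injective (≡ᵇ≡true⇒≡ (toℕ i) (toℕ j) e)

=ᶠ-refl : ∀ {n} (i : Fin n) → (i =ᶠ i) ≡ true
=ᶠ-refl i = ≡ᵇ-refl (toℕ i)

nonemptyᵇ : ∀ {n} → Subset n → Bool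
nonemptyᵇ = foldr′ _∨_ false

x∈p⇒nonemptyᵇ : ∀ {n} {x : Fin n} {p : Subset n} → x ∈ p → nonemptyᵇ p ≡ true
x∈p⇒nonemptyᵇ here = refl
x∈p⇒nonemptyᵇ {p = b ∷ p} (there x∈p) = trans (cong (b ∨_) (x∈p⇒nonemptyᵇ x∈p)) (∨-zeroʳ b)

∣q∣≤∣p++q∣ : ∀ {m n} (p : Subset m) (q : Subset n) → ∣ q ∣ ≤ ∣ p ++ q ∣
∣q∣≤∣p++q∣ []      q = ≤-refl
∣q∣≤∣p++q∣ (b ∷ p) q = ≤-trans (∣q∣≤∣p++q∣ p q) (∣p∣≤∣x∷p∣ b (p ++ q))

∣nonemptyᵇ∷∣≤∣++∣ : ∀ {k m n} (p : Subset k) (q : Subset m) (r : Subset n) →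
                    ∣ q ∣ ≤ ∣ r ∣ → ∣ nonemptyᵇ p ∷ q ∣ ≤ ∣ p ++ r ∣
∣nonemptyᵇ∷∣≤∣++∣ []          q r q≤r = q≤r
∣nonemptyᵇ∷∣≤∣++∣ (true  ∷ p) q r q≤r = s≤s (≤-trans q≤r (∣q∣≤∣p++q∣ p r))
∣nonemptyᵇ∷∣≤∣++∣ (false ∷ p) q r q≤r = ∣nonemptyᵇ∷∣≤∣++∣ p q r q≤r

∣map-nonemptyᵇ∣≤∣concat∣ : ∀ {m n} (pss : Vec (Subset n) m) → ∣ map nonemptyᵇ pss ∣ ≤ ∣ concat pss ∣
∣map-nonemptyᵇ∣≤∣concat∣ []         = z≤n
∣map-nonemptyᵇ∣≤∣concat∣ (p ∷ pss) =
  ∣nonemptyᵇ∷∣≤∣++∣ p (map nonemptyᵇ pss) (concat pss) (∣map-nonemptyᵇ∣≤∣concat∣ pss)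

-- Subset (m * n) is laid out row-major: ⟨ g , h ⟩ = combine g h is entry h of row g.
module _ {m n : ℕ} where

  rows : Subset (m * n) → Vec (Subset n) m
  rows S = proj₁ (group m n S)

  concat-rows : (S : Subset (m * n)) → S ≡ concat (rows S)
  concat-rows S = proj₂ (group m n S)

  project : Subset (m * n) → Subset m
  project S = map nonemptyᵇ (rows S)

  combine∈⇒∈project : ∀ {S g h} → combine g h ∈ S → g ∈ project S
  combine∈⇒∈project {S} {g} {h} gh∈S = lookup⇒[]= g (project S) (begin
    lookup (map nonemptyᵇ (rows S)) g ≡⟨ lookup-map g nonemptyᵇ (rows S) ⟩
    nonemptyᵇ (lookup (rows S) g)     ≡⟨ x∈p⇒nonemptyᵇ (lookup⇒[]= h (lookup (rows S) g) h∈row) ⟩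
    true                              ∎)
    where
    open ≡-Reasoning
    h∈row : lookup (lookup (rows S) g) h ≡ true
    h∈row = trans (sym (lookup-concat (rows S) g h))
                  ([]=⇒lookup (subst (combine g h ∈_) (concat-rows S) gh∈S))

  ∣project-S∣≤∣S∣ : (S : Subset (m * n)) → ∣ project S ∣ ≤ ∣ S ∣
  ∣project-S∣≤∣S∣ S =
    subst (λ T → ∣ project S ∣ ≤ ∣ T ∣) (sym (concat-rows S)) (∣map-nonemptyᵇ∣≤∣concat∣ (rows S))

∣⊥++q∣ : ∀ k {n} (q : Subset n) → ∣ ⊥ {k} ++ q ∣ ≡ ∣ q ∣
∣⊥++q∣ zero    q = refl
∣⊥++q∣ (suc k) q = ∣⊥++q∣ k q

module _ {k : ℕ} where

  layer₀ : ∀ {m} → Subset m → Subset (m * suc k)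
  layer₀ D = concat (map (_∷ ⊥) D)

  ∈layer₀ : ∀ {m} {D : Subset m} {g} → g ∈ D → combine g zero ∈ layer₀ D
  ∈layer₀ {D = D} {g} g∈D = lookup⇒[]= (combine g zero) (layer₀ D) (begin
    lookup (concat (map (_∷ ⊥) D)) (combine g zero) ≡⟨ lookup-concat (map (_∷ ⊥) D) g zero ⟩
    lookup (lookup (map (_∷ ⊥) D) g) zero           ≡⟨ cong (λ p → lookup p zero) (lookup-map g (_∷ ⊥) D) ⟩
    lookup D g                                      ≡⟨ []=⇒lookup g∈D ⟩
    true                                            ∎)
    where open ≡-Reasoning

  ∣layer₀∣ : ∀ {m} (D : Subset m) → ∣ layer₀ D ∣ ≡ ∣ D ∣
  ∣layer₀∣ []          = refl
  ∣layer₀∣ (true  ∷ D) = cong suc (trans (∣⊥++q∣ k (layer₀ D)) (∣layer₀∣ D))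
  ∣layer₀∣ (false ∷ D) = trans (∣⊥++q∣ k (layer₀ D)) (∣layer₀∣ D)

module CartesianProduct (G H : Graph) where

  ⟨_,_⟩ : V G → V H → V (G □ H)
  ⟨_,_⟩ = combine

  π₁ : V (G □ H) → V G
  π₁ x = proj₁ (remQuot {size G} (size H) x)

  π₁-⟨⟩ : ∀ g h → π₁ ⟨ g , h ⟩ ≡ g
  π₁-⟨⟩ g h = cong proj₁ (remQuot-combine g h)

  data Coordinates : V (G □ H) → Set where
    coords : ∀ g h → Coordinates ⟨ g , h ⟩

  coordinates : ∀ x → Coordinates x
  coordinates x with combine-surjective {size G} {size H} x
  ... | g , h , refl = coords g h

  adj-⟨⟩ : ∀ g g' h h' →
           adj (G □ H) ⟨ g , h ⟩ ⟨ g' , h' ⟩ ≡ ((g =ᶠ g') ∧ adj H h h') ∨ ((h =ᶠ h') ∧ adj G g g')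
  adj-⟨⟩ g g' h h' = cong₂ adjacent (remQuot-combine g h) (remQuot-combine g' h')
    where
    adjacent : V G × V H → V G × V H → Bool
    adjacent (g , h) (g' , h') = ((g =ᶠ g') ∧ adj H h h') ∨ ((h =ᶠ h') ∧ adj G g g')

  adjᴴ : ∀ {g h h'} → Adj H h h' → Adj (G □ H) ⟨ g , h ⟩ ⟨ g , h' ⟩
  adjᴴ {g} {h} {h'} a rewrite adj-⟨⟩ g g h h' | =ᶠ-refl g | a = refl

  adjᴳ : ∀ {g g' h} → Adj G g g' → Adj (G □ H) ⟨ g , h ⟩ ⟨ g' , h ⟩
  adjᴳ {g} {g'} {h} a rewrite adj-⟨⟩ g g' h h | =ᶠ-refl h | a = ∨-zeroʳ _

  adj-cases : ∀ {g g' h h'} → Adj (G □ H) ⟨ g , h ⟩ ⟨ g' , h' ⟩ →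
              (g ≡ g' × Adj H h h') ⊎ (h ≡ h' × Adj G g g')
  adj-cases {g} {g'} {h} {h'} a with ∨≡true⇒ ((g =ᶠ g') ∧ adj H h h') (trans (sym (adj-⟨⟩ g g' h h')) a)
  ... | inj₁ e = let g=g' , aH = ∧≡true⇒ (g =ᶠ g') e in inj₁ (=ᶠ⇒≡ g g' g=g' , aH)
  ... | inj₂ e = let h=h' , aG = ∧≡true⇒ (h =ᶠ h') e in inj₂ (=ᶠ⇒≡ h h' h=h' , aG)

  module _ (S : Subset (size G * size H)) where

    project-InN : ∀ {g h} → InN (G □ H) S ⟨ g , h ⟩ → InN G (project S) g
    project-InN (inj₁ gh∈S) = inj₁ (combine∈⇒∈project gh∈S)
    project-InN (inj₂ (u , u∈S , a)) with coordinates u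
    ... | coords g' h' with adj-cases a
    ...   | inj₁ (refl , _)  = inj₁ (combine∈⇒∈project u∈S)
    ...   | inj₂ (refl , aG) = inj₂ (g' , combine∈⇒∈project u∈S , aG)

    Projected : V (G □ H) → Set
    Projected x = InCl G (InN G (project S)) (π₁ x)

    projected : ∀ {g h} → InCl G (InN G (project S)) g → Projected ⟨ g , h ⟩
    projected {g} {h} = subst (InCl G _) (sym (π₁-⟨⟩ g h))

    unprojected : ∀ {g h} → Projected ⟨ g , h ⟩ → InCl G (InN G (project S)) g
    unprojected {g} {h} = subst (InCl G _) (π₁-⟨⟩ g h)

    project-closure : ∀ {x} → InCl (G □ H) (InN (G □ H) S) x → Projected x
    project-closure {x} (base x∈N[S]) with coordinates x
    ... | coords g h = projected (base (project-InN x∈N[S]))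
    project-closure (force {u} {v} cu a others) with coordinates u | coordinates v
    ... | coords g h | coords g' h' with adj-cases a
    ...   | inj₁ (refl , _)  = projected (unprojected (project-closure cu))
    ...   | inj₂ (refl , aG) = projected (force (unprojected (project-closure cu)) aG forced)
      where
      forced : ∀ w → Adj G g w → w ≢ g' → InCl G (InN G (project S)) w
      forced w aw w≢g' = unprojected
        (project-closure (others ⟨ w , h ⟩ (adjᴳ aw) (λ eq → w≢g' (combine-injectiveˡ w h g' h eq))))

    project-powerDominating : V H → IsPowerDominating (G □ H) S → IsPowerDominating G (project S)
    project-powerDominating h pd g = unprojected (project-closure (pd ⟨ g , h ⟩))

  lift-closure : ∀ {U X} → (∀ {u} → U u → ∀ h → InCl (G □ H) X ⟨ u , h ⟩) →
                 ∀ {v} → InCl G U v → ∀ h → InCl (G □ H) X ⟨ v , h ⟩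
  lift-closure U×H⊆cl (base u∈U) h = U×H⊆cl u∈U h
  lift-closure {X = X} U×H⊆cl (force {u} {v} cu a others) h =
    force (lift-closure U×H⊆cl cu h) (adjᴳ a) forced
    where
    forced : ∀ w → Adj (G □ H) ⟨ u , h ⟩ w → w ≢ ⟨ v , h ⟩ → InCl (G □ H) X w
    forced w aw w≢ with coordinates w
    ... | coords g' h' with adj-cases aw
    ...   | inj₁ (refl , _)  = lift-closure U×H⊆cl cu h'
    ...   | inj₂ (refl , aG) = lift-closure U×H⊆cl (others g' aG (λ { refl → w≢ refl })) h

Path-adj-inject₁-suc : ∀ {k} (i : Fin k) → Adj (Path (suc k)) (inject₁ i) (suc i)
Path-adj-inject₁-suc i rewrite toℕ-inject₁ i | ≡ᵇ-refl (toℕ i) = refl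

Path-adj-cases : ∀ {n} {i j : Fin n} → Adj (Path n) i j → suc (toℕ i) ≡ toℕ j ⊎ suc (toℕ j) ≡ toℕ i
Path-adj-cases {i = i} {j} a with ∨≡true⇒ (suc (toℕ i) ≡ᵇ toℕ j) a
... | inj₁ up   = inj₁ (≡ᵇ≡true⇒≡ _ _ up)
... | inj₂ down = inj₂ (≡ᵇ≡true⇒≡ _ _ down)

module _ (G : Graph) (k : ℕ) where
  open CartesianProduct G (Path (suc k))

  layer-by-layer : ∀ {X} → (∀ g → InCl (G □ Path (suc k)) X ⟨ g , zero ⟩) →
                   ∀ j → Acc _<_ j → ∀ g → InCl (G □ Path (suc k)) X ⟨ g , j ⟩
  layer-by-layer bottom zero    _           g = bottom g
  layer-by-layer {X} bottom (suc i) (acc below) g =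
    force (previous g) (adjᴴ (Path-adj-inject₁-suc i)) forced
    where
    previous : ∀ g → InCl (G □ Path (suc k)) X ⟨ g , inject₁ i ⟩
    previous = layer-by-layer bottom (inject₁ i) (below (≤̄⇒inject₁< ≤-refl))
    forced : ∀ w → Adj (G □ Path (suc k)) ⟨ g , inject₁ i ⟩ w → w ≢ ⟨ g , suc i ⟩ →
             InCl (G □ Path (suc k)) X w
    forced w aw w≢ with coordinates w
    ... | coords g' j with adj-cases aw
    ...   | inj₂ (refl , _) = previous g'
    ...   | inj₁ (refl , aP) with Path-adj-cases aP
    ...     | inj₁ up   =
      ⊥-elim (w≢ (cong ⟨ g ,_⟩ (toℕ-injective (trans (sym up) (cong suc (toℕ-inject₁ i))))))
    ...     | inj₂ down =
      layer-by-layer bottom j (below (m≤n⇒m≤1+n (≤-reflexive (trans down (toℕ-inject₁ i))))) g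

  dominating⇒layer₀-powerDominating : ∀ {D} → IsDominating G D → IsPowerDominating (G □ Path (suc k)) (layer₀ D)
  dominating⇒layer₀-powerDominating {D} dom x with coordinates x
  ... | coords g h = layer-by-layer bottom h (<-wellFounded h) g
    where
    bottom : ∀ g → InCl (G □ Path (suc k)) (InN (G □ Path (suc k)) (layer₀ D)) ⟨ g , zero ⟩
    bottom g with dom g
    ... | inj₁ g∈D            = base (inj₁ (∈layer₀ g∈D))
    ... | inj₂ (u , u∈D , a) = base (inj₂ (⟨ u , zero ⟩ , ∈layer₀ u∈D , adjᴳ a))

module _ (G : Graph) where
  open CartesianProduct G (Path 2)

  zeroForcing⇒layer₀-powerDominating : ∀ {U} → IsZeroForcing G U → IsPowerDominating (G □ Path 2) (layer₀ U)
  zeroForcing⇒layer₀-powerDominating {U} zf x with coordinates x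
  ... | coords v h = lift-closure both-layers (zf v) h
    where
    both-layers : ∀ {u} → u ∈ U → ∀ h → InCl (G □ Path 2) (InN (G □ Path 2) (layer₀ U)) ⟨ u , h ⟩
    both-layers u∈U zero       = base (inj₁ (∈layer₀ u∈U))
    both-layers u∈U (suc zero) = base (inj₂ (⟨ _ , zero ⟩ , ∈layer₀ u∈U , adjᴴ refl))

minCard-≤ : ∀ {m n} {P : Subset m → Set} {Q : Subset n → Set} {a b} →
            IsMinCard P a → IsMinCard Q b → (f : Subset n → Subset m) →
            (∀ {S} → Q S → P (f S)) → (∀ S → ∣ f S ∣ ≤ ∣ S ∣) → a ≤ b
minCard-≤ (_ , a≤) ((S , QS , ∣S∣≡b) , _) f Q⇒P f-shrinks =
  ≤-trans (a≤ (f S) (Q⇒P QS)) (subst (∣ f S ∣ ≤_) ∣S∣≡b (f-shrinks S))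

γP≤γP□ : ∀ {G H a b} → V H → IsPowerDomNumber G a → IsPowerDomNumber (G □ H) b → a ≤ b
γP≤γP□ {G} {H} h γP γP□ =
  minCard-≤ γP γP□ project (CartesianProduct.project-powerDominating G H _ h) (∣project-S∣≤∣S∣ {size G})

γP□P≤γ : ∀ {G k b c} → IsPowerDomNumber (G □ Path (suc k)) b → IsDomNumber G c → b ≤ c
γP□P≤γ {G} {k} γP□ γ =
  minCard-≤ γP□ γ layer₀ (dominating⇒layer₀-powerDominating G k) (λ D → ≤-reflexive (∣layer₀∣ D))

γP□P₂≤Z : ∀ {G b z} → IsPowerDomNumber (G □ Path 2) b → IsZeroForcingNumber G z → b ≤ z
γP□P₂≤Z {G} γP□ Z =
  minCard-≤ γP□ Z layer₀ (zeroForcing⇒layer₀-powerDominating G) (λ U → ≤-reflexive (∣layer₀∣ U))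

mainTheorem12 : (G : Graph) → IsSimple G → Connected G →
    (∀ (n : ℕ) → 1 ≤ n → ∀ a b c →
       IsPowerDomNumber G a → IsPowerDomNumber (G □ Path n) b → IsDomNumber G c →
       (a ≤ b × b ≤ c) × (a ≡ c → b ≡ c))
    × (∀ a b c z →
       IsPowerDomNumber G a → IsPowerDomNumber (G □ Path 2) b → IsDomNumber G c →
       IsZeroForcingNumber G z →
       a ≤ b × b ≤ c ⊓ z)
mainTheorem12 G _ _ = bounds , λ a b c z γP γP□ γ Z →
  let (a≤b , b≤c) , _ = bounds 2 (s≤s z≤n) a b c γP γP□ γ in
  a≤b , ⊓-glb b≤c (γP□P₂≤Z γP□ Z)
  where
  bounds : ∀ n → 1 ≤ n → ∀ a b c →
           IsPowerDomNumber G a → IsPowerDomNumber (G □ Path n) b → IsDomNumber G c →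
           (a ≤ b × b ≤ c) × (a ≡ c → b ≡ c)
  bounds (suc k) _ a b c γP γP□ γ = (a≤b , b≤c) , λ a≡c → ≤-antisym b≤c (subst (_≤ b) a≡c a≤b)
    where
    a≤b : a ≤ b
    a≤b = γP≤γP□ {H = Path (suc k)} zero γP γP□
    b≤c : b ≤ c
    b≤c = γP□P≤γ {k = k} γP□ γ
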